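{- Let $(X,\tau)$ be a $T_d$-space with derivative $d=d_\tau$, and let $x\in X$, $U\subseteq X$. Then $U$ contains a $\tau^+$-open neighbourhood of $x$ if and only if one of the following holds: (i) $x$ is not doubly $d$-reflexive and $x\in U$; (ii) $x$ is doubly $d$-reflexive and there exist $A\in\tau$ and $B\subseteq X$ such that $x\in A\cap dB\subseteq U$.
   Context: For $A\subseteq X$, $d(A)$ is the set of limit points of $A$ in $(X,\tau)$. $(X,\tau)$ is $T_d$ if $d(A)$ is closed for every $A\subseteq X$. $\tau^+$ is the coarsest topology on $X$ containing $\tau$ in which every set $d(A)$, $A\subseteq X$, is open. A point $x$ is doubly $d$-reflexive if $x\in d(X)$ and for all $A_1,A_2\subseteq X$, $x\in dA_1\cap dA_2$ implies $x\in d(dA_1\cap dA_2)$. -}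

module Defs where

open import Level using (0ℓ)
open import Data.Product using (Σ; _×_; ∃)
open import Data.Unit using (⊤)
open import Relation.Nullary using (¬_)
open import Relation.Binary.PropositionalEquality using (_≢_)

Subset : Set → Set₁
Subset X = X → Set

module _ {X : Set} where
  _∈_ : X → Subset X → Set
  x ∈ A = A x

  _⊆_ : Subset X → Subset X → Set
  A ⊆ B = ∀ x → A x → B x

  _∩_ : Subset X → Subset X → Subset X
  (A ∩ B) x = A x × B x

  ∁ : Subset X → Subset X
  ∁ A x = ¬ A x

  full : Subset X
  full _ = ⊤

  ⋃ : {I : Set} → (I → Subset X) → Subset X
  ⋃ {I} F x = Σ I (λ i → F i x)

_≐_ : {X : Set} → Subset X → Subset X → Set
A ≐ B = ∀ x → (A x → B x) × (B x → A x)

-- To stay predicative (subsets live in Set₁), the open sets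
-- are presented by a type of codes `Opn` with interpretation `⟦_⟧`; a subset
-- is open iff it is pointwise equal to some ⟦ o ⟧.
record Topology (X : Set) : Set₁ where
  field
    Opn      : Set
    ⟦_⟧      : Opn → Subset X
    open-full : Σ Opn (λ o → ⟦ o ⟧ ≐ full)
    open-∩   : ∀ o p → Σ Opn (λ q → ⟦ q ⟧ ≐ (⟦ o ⟧ ∩ ⟦ p ⟧))
    open-⋃   : (I : Set) (F : I → Opn) → Σ Opn (λ q → ⟦ q ⟧ ≐ ⋃ (λ i → ⟦ F i ⟧))

  Open : Subset X → Set
  Open U = Σ Opn (λ o → ⟦ o ⟧ ≐ U)

module _ {X : Set} (τ : Topology X) where
  open Topology τ

  Closed : Subset X → Set
  Closed A = Open (∁ A)

  d : Subset X → Subset X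
  d A x = ∀ (o : Opn) → x ∈ ⟦ o ⟧ → ∃ λ y → y ∈ ⟦ o ⟧ × y ∈ A × y ≢ x

  IsTd : Set₁
  IsTd = ∀ A → Closed (d A)

  -- U is open in τ⁺, the coarsest topology containing τ in which every d(A)
  -- is open: U is open in every such topology.
  Open⁺ : Subset X → Set₁
  Open⁺ U = (σ : Topology X)
          → (∀ V → Open V → Topology.Open σ V)
          → (∀ A → Topology.Open σ (d A))
          → Topology.Open σ U

  DoublyReflexive : X → Set₁
  DoublyReflexive x =
    x ∈ d full × (∀ A₁ A₂ → x ∈ d A₁ → x ∈ d A₂ → x ∈ d (d A₁ ∩ d A₂))

module Submission where

-- The topology τ⁺ is only given implicitly (as the coarsest topology
-- containing τ in which every derived set d(A) is open), so each direction
-- is proved against a suitable topology.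
--
-- (⇐) Sets A ∩ d(B) with A ∈ τ are τ⁺-open because τ⁺ is closed under
--     binary intersections.  If x is not doubly d-reflexive, then {x} is
--     τ⁺-open: either x ∉ d(X), so {x} is τ-open, or some x ∈ dA₁ ∩ dA₂
--     is not a limit point of dA₁ ∩ dA₂, so {x} = O ∩ dA₁ ∩ dA₂ for a
--     τ-open O.  Using T_d (d(dB) ⊆ dB) the admissible
--     sets are closed under X, ∩ and ⋃, so, classically, they form a
--     topology.  It contains τ and every d(A), hence it contains τ⁺, and
--     admissibility of a τ⁺-neighbourhood of x is exactly condition (ii).

open import Defs
open import Level using (0ℓ; lift; lower)
open import Axiom.ExcludedMiddle using (ExcludedMiddle)
open import Data.Product using (Σ; _×_; _,_; proj₁; proj₂)
open import Data.Sum using (_⊎_; inj₁; inj₂)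
open import Data.Bool using (Bool; T)
open import Data.Empty using (⊥; ⊥-elim)
open import Data.Unit using (tt)
open import Relation.Nullary using (¬_; yes; no)
open import Relation.Nullary.Decidable
  using (⌊_⌋; True; toWitness; fromWitness; map′; decidable-stable)
open import Relation.Binary.PropositionalEquality using (_≡_; refl)
open import Function.Bundles using (_⇔_; mk⇔)

LEM : Set₂
LEM = ExcludedMiddle (Level.suc 0ℓ)

≐-sym : {X : Set} {A B : Subset X} → A ≐ B → B ≐ A
≐-sym e y = proj₂ (e y) , proj₁ (e y)

≐-trans : {X : Set} {A B C : Subset X} → A ≐ B → B ≐ C → A ≐ C
≐-trans e f y = (λ a → proj₁ (f y) (proj₁ (e y) a)) , (λ c → proj₂ (e y) (proj₂ (f y) c))

module _ {X : Set} (σ : Topology X) where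
  open Topology σ

  Open-resp : {A B : Subset X} → Open A → A ≐ B → Open B
  Open-resp (o , e) f = o , ≐-trans e f

  ⟦⟧-Open : ∀ o → Open ⟦ o ⟧
  ⟦⟧-Open o = o , λ _ → (λ h → h) , (λ h → h)

  Open-∩ : {A B : Subset X} → Open A → Open B → Open (A ∩ B)
  Open-∩ (a , ea) (b , eb) with open-∩ a b
  ... | q , eq = q , λ y →
    (λ q∋y → let (a∋y , b∋y) = proj₁ (eq y) q∋y
             in proj₁ (ea y) a∋y , proj₁ (eb y) b∋y)
    , (λ (Ay , By) → proj₂ (eq y) (proj₂ (ea y) Ay , proj₂ (eb y) By))

module Classical (lem : LEM) where

  lem₀ : ExcludedMiddle 0ℓ
  lem₀ = map′ lower lift lem

  dne₀ : {Q : Set} → ¬ ¬ Q → Q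
  dne₀ = decidable-stable lem₀

  dne₁ : {Q : Set₁} → ¬ ¬ Q → Q
  dne₁ = decidable-stable lem

-- Codes of open sets are Boolean characteristic functions; a
-- code denotes its subset if that subset is in the family, and ∅ otherwise.
module TopologyFromPredicate {X : Set} (lem : LEM)
  (P : Subset X → Set₁)
  (P-resp : ∀ {V W} → V ≐ W → P V → P W)
  (P-full : P full)
  (P-∩ : ∀ {V W} → P V → P W → P (V ∩ W))
  (P-⋃ : (I : Set) (F : I → Subset X) → (∀ i → P (F i)) → P (⋃ F)) where
  open Classical lem

  support : (X → Bool) → Subset X
  support f y = T (f y)

  χ : Subset X → X → Bool
  χ V y = ⌊ lem₀ {V y} ⌋

  support-χ : ∀ V → support (χ V) ≐ V
  support-χ V y = toWitness , fromWitness

  denote : (X → Bool) → Subset X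
  denote f y = support f y × True (lem {P (support f)})

  P-∅ : P (λ _ → ⊥)
  P-∅ = P-resp (λ y → (λ { (() , _) }) , λ ()) (P-⋃ ⊥ ⊥-elim λ ())

  P-denote : ∀ f → P (denote f)
  P-denote f with lem {P (support f)}
  ... | yes Pf = P-resp (λ y → (λ s → s , tt) , proj₁) Pf
  ... | no _   = P-resp (λ y → (λ ()) , λ { (_ , ()) }) P-∅

  code : ∀ V → P V → Σ (X → Bool) (λ f → denote f ≐ V)
  code V PV = χ V , ≐-trans denote≐support (support-χ V)
    where
    Pχ : P (support (χ V))
    Pχ = P-resp (≐-sym (support-χ V)) PV

    denote≐support : denote (χ V) ≐ support (χ V)
    denote≐support y = proj₁ , λ s → s , fromWitness {a? = lem} Pχ

  topology : Topology X
  topology = record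
    { Opn       = X → Bool
    ; ⟦_⟧       = denote
    ; open-full = code full P-full
    ; open-∩    = λ o p → code _ (P-∩ (P-denote o) (P-denote p))
    ; open-⋃    = λ I F → code _ (P-⋃ I (λ i → denote (F i)) (λ i → P-denote (F i)))
    }

  P⇒Open : ∀ {V} → P V → Topology.Open topology V
  P⇒Open {V} = code V

  Open⇒P : ∀ {V} → Topology.Open topology V → P V
  Open⇒P (f , e) = P-resp e (P-denote f)

module DerivedSet {X : Set} (τ : Topology X) where
  open Topology τ

  d-mono : ∀ {A B} → A ⊆ B → d τ A ⊆ d τ B
  d-mono A⊆B x x∈dA o x∈o with x∈dA o x∈o
  ... | y , y∈o , y∈A , y≢x = y , y∈o , A⊆B y y∈A , y≢x

  Open⁺-∩d : ∀ {A} B → Open A → Open⁺ τ (A ∩ d τ B)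
  Open⁺-∩d B A-open σ τ⊆σ dσ = Open-∩ σ (τ⊆σ _ A-open) (dσ B)

  module _ (lem : LEM) where
    open Classical lem

    -- In a T_d space, d(d(B)) ⊆ d(B): the complement of d(B) is an open
    -- neighbourhood of any point outside d(B), and it misses d(B).
    dd⊆d : IsTd τ → ∀ B → d τ (d τ B) ⊆ d τ B
    dd⊆d td B y y∈ddB with td B
    ... | o , o≐∁dB = dne₀ λ y∉dB →
      let (z , z∈o , z∈dB , _) = y∈ddB o (proj₂ (o≐∁dB y) y∉dB)
      in proj₁ (o≐∁dB z) z∈o z∈dB

    isolating-open : ∀ C x → ¬ x ∈ d τ C
      → Σ Opn (λ o → x ∈ ⟦ o ⟧ × (∀ y → y ∈ ⟦ o ⟧ → y ∈ C → y ≡ x))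
    isolating-open C x x∉dC = dne₀ λ none → x∉dC λ o x∈o → dne₀ λ no-y →
      none (o , x∈o , λ y y∈o y∈C → dne₀ λ y≢x → no-y (y , y∈o , y∈C , y≢x))

    non-reflexivity-witness : ∀ x → x ∈ d τ full → ¬ DoublyReflexive τ x
      → Σ (Subset X) λ A₁ → Σ (Subset X) λ A₂ →
          x ∈ d τ A₁ × x ∈ d τ A₂ × ¬ x ∈ d τ (d τ A₁ ∩ d τ A₂)
    non-reflexivity-witness x x∈dX ¬DR = dne₁ λ none → ¬DR (x∈dX , λ A₁ A₂ x∈dA₁ x∈dA₂ →
      dne₀ λ x∉ → none (A₁ , A₂ , x∈dA₁ , x∈dA₂ , x∉))

    singleton-Open⁺ : ∀ x → ¬ DoublyReflexive τ x → Open⁺ τ (λ y → y ≡ x)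
    singleton-Open⁺ x ¬DR σ τ⊆σ dσ with lem₀ {x ∈ d τ full}
    ... | no x∉dX with isolating-open full x x∉dX
    ...   | o , x∈o , o⊆x = Open-resp σ (τ⊆σ _ (⟦⟧-Open τ o))
            λ y → (λ y∈o → o⊆x y y∈o tt) , λ { refl → x∈o }
    singleton-Open⁺ x ¬DR σ τ⊆σ dσ | yes x∈dX
      with non-reflexivity-witness x x∈dX ¬DR
    ... | A₁ , A₂ , x∈dA₁ , x∈dA₂ , x∉ with isolating-open (d τ A₁ ∩ d τ A₂) x x∉
    ... | o , x∈o , o⊆x =
      Open-resp σ (Open-∩ σ (τ⊆σ _ (⟦⟧-Open τ o))
                            (Open-∩ σ (dσ A₁) (dσ A₂)))
        λ y → (λ (y∈o , y∈dA) → o⊆x y y∈o y∈dA) , λ { refl → x∈o , x∈dA₁ , x∈dA₂ }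

module Admissible {X : Set} (lem : LEM) (τ : Topology X) (td : IsTd τ) where
  open Topology τ
  open DerivedSet τ

  BasicNbhd : X → Subset X → Set₁
  BasicNbhd x W = Σ (Subset X) λ A → Σ (Subset X) λ B →
    Open A × x ∈ (A ∩ d τ B) × (A ∩ d τ B) ⊆ W

  BasicNbhd-mono : ∀ {x V W} → V ⊆ W → BasicNbhd x V → BasicNbhd x W
  BasicNbhd-mono V⊆W (A , B , A-open , x∈ , ⊆V) = A , B , A-open , x∈ , λ y h → V⊆W y (⊆V y h)

  Admissible : Subset X → Set₁
  Admissible W = ∀ w → w ∈ W → DoublyReflexive τ w → BasicNbhd w W

  admissible-resp : ∀ {V W} → V ≐ W → Admissible V → Admissible W
  admissible-resp V≐W adm w w∈W DR =
    BasicNbhd-mono (λ y → proj₁ (V≐W y)) (adm w (proj₂ (V≐W w) w∈W) DR)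

  -- Every τ-open set A is admissible, as A = A ∩ d(X) around a point of d(X).
  admissible-Open : ∀ {A} → Open A → Admissible A
  admissible-Open A-open w w∈A (w∈dX , _) = _ , full , A-open , (w∈A , w∈dX) , λ y → proj₁

  -- Every derived set d(B) = X ∩ d(B) is admissible.
  admissible-d : ∀ B → Admissible (d τ B)
  admissible-d B w w∈dB _ = full , B , open-full , (tt , w∈dB) , λ y → proj₂

  admissible-full : Admissible full
  admissible-full = admissible-Open open-full

  -- Closure under ∩ is where double d-reflexivity and T_d are needed:
  -- A₁ ∩ A₂ ∩ d(dB₁ ∩ dB₂) is a neighbourhood of w contained in both
  -- A₁ ∩ dB₁ and A₂ ∩ dB₂, because d(dBᵢ) ⊆ dBᵢ.
  admissible-∩ : ∀ {V W} → Admissible V → Admissible W → Admissible (V ∩ W)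
  admissible-∩ admV admW w (w∈V , w∈W) DR@(_ , reflexive)
    with admV w w∈V DR | admW w w∈W DR
  ... | A₁ , B₁ , A₁-open , (w∈A₁ , w∈dB₁) , ⊆V | A₂ , B₂ , A₂-open , (w∈A₂ , w∈dB₂) , ⊆W =
    A₁ ∩ A₂ , d τ B₁ ∩ d τ B₂ , Open-∩ τ A₁-open A₂-open ,
    ((w∈A₁ , w∈A₂) , reflexive B₁ B₂ w∈dB₁ w∈dB₂) ,
    λ y ((y∈A₁ , y∈A₂) , y∈d∩) →
      ⊆V y (y∈A₁ , dd⊆d lem td B₁ y (d-mono (λ _ → proj₁) y y∈d∩)) ,
      ⊆W y (y∈A₂ , dd⊆d lem td B₂ y (d-mono (λ _ → proj₂) y y∈d∩))

  admissible-⋃ : (I : Set) (F : I → Subset X) → (∀ i → Admissible (F i)) → Admissible (⋃ F)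
  admissible-⋃ I F adm w (i , w∈Fi) DR = BasicNbhd-mono (λ y y∈Fi → i , y∈Fi) (adm i w w∈Fi DR)

  open TopologyFromPredicate lem Admissible admissible-resp admissible-full
    admissible-∩ admissible-⋃

  -- The admissible sets form a topology containing τ and every d(B), so
  -- every τ⁺-open set is admissible.
  Open⁺⇒Admissible : ∀ {V} → Open⁺ τ V → Admissible V
  Open⁺⇒Admissible V-open = Open⇒P (V-open topology
    (λ _ A-open → P⇒Open (admissible-Open A-open))
    (λ B → P⇒Open (admissible-d B)))

module Neighbourhoods {X : Set} (lem : LEM) (τ : Topology X) (td : IsTd τ) (x : X) (U : Subset X) where
  open DerivedSet τ
  open Admissible lem τ td

  Open⁺Nbhd : Set₁
  Open⁺Nbhd = Σ (Subset X) (λ V → Open⁺ τ V × x ∈ V × V ⊆ U)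

  Criterion : Set₁
  Criterion = (¬ DoublyReflexive τ x × x ∈ U) ⊎ (DoublyReflexive τ x × BasicNbhd x U)

  sufficient : Criterion → Open⁺Nbhd
  sufficient (inj₁ (¬DR , x∈U)) = (λ y → y ≡ x) , singleton-Open⁺ lem x ¬DR , refl , λ { _ refl → x∈U }
  sufficient (inj₂ (_ , A , B , A-open , x∈ , ⊆U)) = A ∩ d τ B , Open⁺-∩d B A-open , x∈ , ⊆U

  necessary : Open⁺Nbhd → Criterion
  necessary (V , V-open , x∈V , V⊆U) with lem {DoublyReflexive τ x}
  ... | no ¬DR = inj₁ (¬DR , V⊆U x x∈V)
  ... | yes DR = inj₂ (DR , BasicNbhd-mono V⊆U (Open⁺⇒Admissible V-open x x∈V DR))

mainTheorem5 : ExcludedMiddle (Level.suc 0ℓ)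
    → {X : Set} (τ : Topology X) → IsTd τ → (x : X) (U : Subset X)
    → (Σ (Subset X) (λ V → Open⁺ τ V × x ∈ V × V ⊆ U))
      ⇔ ((¬ DoublyReflexive τ x × x ∈ U)
         ⊎ (DoublyReflexive τ x
            × Σ (Subset X) (λ A → Σ (Subset X) (λ B →
                Topology.Open τ A × x ∈ (A ∩ d τ B) × (A ∩ d τ B) ⊆ U))))
mainTheorem5 lem τ td x U = mk⇔ necessary sufficient
  where open Neighbourhoods lem τ td x U
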